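{- Let $n\ge 2$. Every deterministic synchronous mutual search algorithm for two agents on $n$ sites has cost at least $\lceil n/2\rceil$.
   Context: A deterministic synchronous mutual search (MS) algorithm for two agents on sites $V=\{0,\ldots,n-1\}$ is an ordered tournament $T=(V,E,\prec)$: $E$ contains, for each unordered pair $\{i,j\}$ of distinct sites, exactly one of the arcs $(i,j)$, $(j,i)$ (arc $(i,j)$: an agent at $i$ queries $j$), and $\prec$ is a total order on $E$ (the time order of the queries). Row $E_i$ is the set of arcs leaving $i$. The cost of an arc $e=(i,j)$ is $c(e)=|\{f\in E_i: f\prec e\}|+1+|\{f\in E_j: f\prec e\}|$ (the number of queries made until contact if the agents sit at $i$ and $j$), and the cost of $T$ is $\max_{e\in E}c(e)$. -}

module Defs where

open import Data.Nat using (ℕ; _+_; _⊔_)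
open import Data.Fin using (Fin; _≟_)
open import Data.Product using (_×_; _,_; proj₁; proj₂)
open import Data.Sum using (_⊎_)
open import Data.List using (List; []; _∷_; length; filter; foldr; _++_; [_])
open import Data.List.Membership.Propositional using (_∈_)
open import Data.List.Relation.Unary.Unique.Propositional using (Unique)
open import Data.List.Relation.Unary.All using (All)
open import Relation.Binary.PropositionalEquality using (_≡_)
open import Relation.Nullary using (¬_)

-- An arc (i , j): an agent at site i queries site j.
Arc : ℕ → Set
Arc n = Fin n × Fin n

-- An ordered tournament on sites Fin n: the arc set E together with the
-- total order ≺ on E, represented as the list of the arcs of E in
-- ≺-increasing (time) order, without repetitions.
record OrderedTournament (n : ℕ) : Set where
  field
    arcs     : List (Arc n)
    unique   : Unique arcs
    noLoops  : All (λ e → ¬ (proj₁ e ≡ proj₂ e)) arcs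
    complete : ∀ (i j : Fin n) → ¬ (i ≡ j) → ((i , j) ∈ arcs) ⊎ ((j , i) ∈ arcs)
    antisym  : ∀ (i j : Fin n) → (i , j) ∈ arcs → ¬ ((j , i) ∈ arcs)

outCount : ∀ {n} → Fin n → List (Arc n) → ℕ
outCount i l = length (filter (λ f → proj₁ f ≟ i) l)

arcCost : ∀ {n} → List (Arc n) → Arc n → ℕ
arcCost pre (i , j) = outCount i pre + 1 + outCount j pre

arcCostsFrom : ∀ {n} → List (Arc n) → List (Arc n) → List ℕ
arcCostsFrom pre []       = []
arcCostsFrom pre (e ∷ es) = arcCost pre e ∷ arcCostsFrom (pre ++ [ e ]) es

cost : ∀ {n} → OrderedTournament n → ℕ
cost T = foldr _⊔_ 0 (arcCostsFrom [] (OrderedTournament.arcs T))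

-- Let d(v) be the out-degree of site v. The last query leaving v has cost at least d(v),
-- so d(v) ≤ cost; the very last query (i, j) has cost exactly d(i) + d(j), and i ≠ j, so
-- Σ d ≤ (n − 1) · cost. On the other hand every pair of sites is joined by an arc, so
-- 2 Σ d ≥ n (n − 1). Together, n ≤ 2 · cost.
module Submission where

open import Defs
open import Data.Nat using (ℕ; zero; suc; _+_; _*_; _⊔_; _≤_; z≤n; s≤s; NonZero; ⌈_/2⌉)
open import Data.Nat.Properties
open import Data.Fin using (Fin; zero; suc; punchIn; punchOut) renaming (_≟_ to _≟ᶠ_)
open import Data.Fin.Properties using (punchIn-punchOut; punchInᵢ≢i)
open import Data.Product using (_,_; proj₁; proj₂; ∃₂)
open import Data.Product.Properties using (≡-dec)
open import Data.Sum using (_⊎_; inj₁; inj₂)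
open import Data.List using (List; []; _∷_; [_]; _++_; _∷ʳ_; length; filter; foldr; initLast; _∷ʳ′_)
open import Data.List.Properties using (++-assoc; ++-identityʳ; filter-++; length-++)
open import Data.List.Relation.Unary.Any using (toSum)
open import Data.List.Relation.Unary.All using (All)
open import Data.List.Relation.Unary.All.Properties using (∷ʳ⁻)
open import Data.List.Membership.Propositional using (_∈_)
open import Data.Vec.Functional using (Vector; removeAt)
open import Function using (_∘_)
open import Relation.Nullary using (¬_; Dec; yes; no; contradiction)
open import Relation.Binary.Definitions using (DecidableEquality)
open import Relation.Binary.PropositionalEquality hiding ([_])
open import Algebra.Properties.CommutativeMonoid.Sum +-0-commutativeMonoid
  using (sum; sum-remove; ∑-distrib-+; ∑-comm; sum-cong-≗; sum-replicate-zero)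

indicator : {P : Set} → Dec P → ℕ
indicator (yes _) = 1
indicator (no _)  = 0

indicator-yes : {P : Set} (p? : Dec P) → P → indicator p? ≡ 1
indicator-yes (yes _) _ = refl
indicator-yes (no ¬p) p = contradiction p ¬p

indicator-no : {P : Set} (p? : Dec P) → ¬ P → indicator p? ≡ 0
indicator-no (yes p) ¬p = contradiction p ¬p
indicator-no (no _)  _  = refl

indicator-mono : {P Q : Set} (p? : Dec P) (q? : Dec Q) → (P → Q) → indicator p? ≤ indicator q?
indicator-mono (no _)  _  _   = z≤n
indicator-mono (yes p) q? P→Q = ≤-reflexive (sym (indicator-yes q? (P→Q p)))

indicator-⊎ : {P Q R : Set} (p? : Dec P) (q? : Dec Q) (r? : Dec R) →
              (P → Q ⊎ R) → indicator p? ≤ indicator q? + indicator r?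
indicator-⊎ (no _)  _  _  _ = z≤n
indicator-⊎ (yes p) q? r? split with split p
... | inj₁ q = ≤-trans (indicator-mono (yes p) q? (λ _ → q)) (m≤m+n _ _)
... | inj₂ r = ≤-trans (indicator-mono (yes p) r? (λ _ → r)) (m≤n+m _ _)

sum-mono-≤ : ∀ {n} {f g : Vector ℕ n} → (∀ i → f i ≤ g i) → sum f ≤ sum g
sum-mono-≤ {zero}  _   = z≤n
sum-mono-≤ {suc n} f≤g = +-mono-≤ (f≤g zero) (sum-mono-≤ (f≤g ∘ suc))

sum-const : ∀ n c → sum {n} (λ _ → c) ≡ n * c
sum-const zero    c = refl
sum-const (suc n) c = cong (c +_) (sum-const n c)

sum-≤-* : ∀ {n} {f : Vector ℕ n} c → (∀ i → f i ≤ c) → sum f ≤ n * c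
sum-≤-* {n} c f≤c = ≤-trans (sum-mono-≤ f≤c) (≤-reflexive (sum-const n c))

*-≤-sum : ∀ {n} {f : Vector ℕ n} c → (∀ i → c ≤ f i) → n * c ≤ sum f
*-≤-sum {n} c c≤f = ≤-trans (≤-reflexive (sym (sum-const n c))) (sum-mono-≤ c≤f)

sum-zero : ∀ {n} {f : Vector ℕ n} → (∀ i → f i ≡ 0) → sum f ≡ 0
sum-zero {n} f≡0 = trans (sum-cong-≗ f≡0) (sum-replicate-zero n)

sum-indicator-≟ : ∀ {n} (b : Fin n) → sum (λ w → indicator (w ≟ᶠ b)) ≡ 1
sum-indicator-≟ {suc n} b = begin
  sum (λ w → indicator (w ≟ᶠ b))
    ≡⟨ sum-remove {i = b} (λ w → indicator (w ≟ᶠ b)) ⟩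
  indicator (b ≟ᶠ b) + sum (λ w → indicator (punchIn b w ≟ᶠ b))
    ≡⟨ cong₂ _+_ (indicator-yes (b ≟ᶠ b) refl)
                 (sum-zero (λ w → indicator-no (punchIn b w ≟ᶠ b) (punchInᵢ≢i b w))) ⟩
  1 ∎
  where open ≡-Reasoning

sum-≤-pred-* : ∀ {m} {f : Vector ℕ (suc (suc m))} {i j} c → i ≢ j →
               (∀ v → f v ≤ c) → f i + f j ≤ c → sum f ≤ suc m * c
sum-≤-pred-* {m} {f} {i} {j} c i≢j f≤c fi+fj≤c = begin
  sum f                              ≡⟨ sum-remove {i = i} f ⟩
  f i + sum (removeAt f i)           ≡⟨ cong (f i +_) (sum-remove {i = j′} (removeAt f i)) ⟩
  f i + (f (punchIn i j′) + rest)    ≡⟨ cong (λ x → f i + (f x + rest)) (punchIn-punchOut i≢j) ⟩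
  f i + (f j + rest)                 ≡⟨ +-assoc (f i) (f j) rest ⟨
  f i + f j + rest                   ≤⟨ +-mono-≤ fi+fj≤c (sum-≤-* c (f≤c ∘ punchIn i ∘ punchIn j′)) ⟩
  c + m * c                          ∎
  where
  open ≤-Reasoning
  j′ = punchOut i≢j
  rest = sum (removeAt (removeAt f i) j′)

square-≤-∑∑-tournament : ∀ {n} (a : Fin n → Fin n → ℕ) →
                         (∀ v w → v ≢ w → 1 ≤ a v w + a w v) →
                         n * n ≤ sum (λ v → sum (a v)) + sum (λ v → sum (a v)) + n
square-≤-∑∑-tournament {n} a total = begin
  n * n                                      ≤⟨ *-≤-sum n row-≥ ⟩
  sum (λ v → sum (g v))
    ≡⟨ sum-cong-≗ {y = λ v → sum (a v) + sum (aᵀ v) + sum (δ v)} split-row ⟩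
  sum (λ v → sum (a v) + sum (aᵀ v) + sum (δ v))
    ≡⟨ trans (∑-distrib-+ (λ v → sum (a v) + sum (aᵀ v)) (λ v → sum (δ v)))
             (cong (_+ sum (λ v → sum (δ v))) (∑-distrib-+ (λ v → sum (a v)) (λ v → sum (aᵀ v)))) ⟩
  ∑∑a + sum (λ v → sum (aᵀ v)) + sum (λ v → sum (δ v))
    ≡⟨ cong₂ (λ x y → ∑∑a + x + y) (∑-comm aᵀ) diagonal ⟩
  ∑∑a + ∑∑a + n                              ∎
  where
  open ≤-Reasoning
  ∑∑a = sum (λ v → sum (a v))
  aᵀ δ g : Fin n → Fin n → ℕ
  aᵀ v w = a w v
  δ v w = indicator (w ≟ᶠ v)
  g v w = a v w + aᵀ v w + δ v w

  covered : ∀ v w → 1 ≤ g v w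
  covered v w with w ≟ᶠ v
  ... | yes _   = m≤n+m 1 _
  ... | no w≢v = ≤-trans (total v w (w≢v ∘ sym)) (m≤m+n _ 0)

  row-≥ : ∀ v → n ≤ sum (g v)
  row-≥ v = ≤-trans (≤-reflexive (sym (*-identityʳ n))) (*-≤-sum 1 (covered v))

  split-row : ∀ v → sum (g v) ≡ sum (a v) + sum (aᵀ v) + sum (δ v)
  split-row v = trans (∑-distrib-+ (λ w → a v w + aᵀ v w) (δ v))
                      (cong (_+ sum (δ v)) (∑-distrib-+ (a v) (aᵀ v)))

  diagonal : sum (λ v → sum (δ v)) ≡ n
  diagonal = trans (sum-cong-≗ {n} {y = λ _ → 1} sum-indicator-≟) (trans (sum-const n 1) (*-identityʳ n))

∈⇒∷ʳ : ∀ {A : Set} {x : A} {xs : List A} → x ∈ xs → ∃₂ λ ys y → xs ≡ ys ∷ʳ y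
∈⇒∷ʳ {xs = xs} x∈xs with initLast xs
∈⇒∷ʳ () | []
∈⇒∷ʳ _  | ys ∷ʳ′ y = ys , y , refl

module _ {n : ℕ} where

  outCount-++ : ∀ (v : Fin n) xs ys → outCount v (xs ++ ys) ≡ outCount v xs + outCount v ys
  outCount-++ v xs ys = trans (cong length (filter-++ (λ f → proj₁ f ≟ᶠ v) xs ys))
                              (length-++ (filter (λ f → proj₁ f ≟ᶠ v) xs))

  arcCost-last : ∀ pre {i j : Fin n} → i ≢ j →
                 outCount i (pre ∷ʳ (i , j)) + outCount j (pre ∷ʳ (i , j)) ≡ arcCost pre (i , j)
  arcCost-last pre {i} {j} i≢j
    rewrite outCount-++ i pre [ (i , j) ] | outCount-++ j pre [ (i , j) ]
    with i ≟ᶠ i | i ≟ᶠ j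
  ... | no i≢i | _       = contradiction refl i≢i
  ... | _      | yes i≡j = contradiction i≡j i≢j
  ... | yes _  | no _    = cong (outCount i pre + 1 +_) (+-identityʳ (outCount j pre))

  outCount-∷ʳ-≤ : ∀ (v : Fin n) pre e → outCount v (pre ∷ʳ e) ≤ outCount v pre ⊔ arcCost pre e
  outCount-∷ʳ-≤ v pre (i , j) rewrite outCount-++ v pre [ (i , j) ] with i ≟ᶠ v
  ... | yes refl = m≤n⇒m≤o⊔n (outCount i pre) (m≤m+n (outCount i pre + 1) (outCount j pre))
  ... | no _     = m≤n⇒m≤n⊔o (arcCost pre (i , j)) (≤-reflexive (+-identityʳ (outCount v pre)))

  maxCostFrom : List (Arc n) → List (Arc n) → ℕ
  maxCostFrom pre l = foldr _⊔_ 0 (arcCostsFrom pre l)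

  outCount-≤-maxCostFrom : ∀ (v : Fin n) pre l → outCount v (pre ++ l) ≤ outCount v pre ⊔ maxCostFrom pre l
  outCount-≤-maxCostFrom v pre [] rewrite ++-identityʳ pre = m≤m⊔n _ _
  outCount-≤-maxCostFrom v pre (e ∷ l) = begin
    outCount v (pre ++ e ∷ l)                         ≡⟨ cong (outCount v) (++-assoc pre [ e ] l) ⟨
    outCount v ((pre ∷ʳ e) ++ l)                      ≤⟨ outCount-≤-maxCostFrom v (pre ∷ʳ e) l ⟩
    outCount v (pre ∷ʳ e) ⊔ maxCostFrom (pre ∷ʳ e) l  ≤⟨ ⊔-monoˡ-≤ _ (outCount-∷ʳ-≤ v pre e) ⟩
    outCount v pre ⊔ arcCost pre e ⊔ maxCostFrom (pre ∷ʳ e) l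
                                                      ≡⟨ ⊔-assoc (outCount v pre) _ _ ⟩
    outCount v pre ⊔ maxCostFrom pre (e ∷ l)          ∎
    where open ≤-Reasoning

  arcCost-≤-maxCostFrom : ∀ pre l e → arcCost (pre ++ l) e ≤ maxCostFrom pre (l ∷ʳ e)
  arcCost-≤-maxCostFrom pre []      e rewrite ++-identityʳ pre = m≤m⊔n _ _
  arcCost-≤-maxCostFrom pre (x ∷ l) e = begin
    arcCost (pre ++ x ∷ l) e                 ≡⟨ cong (λ q → arcCost q e) (++-assoc pre [ x ] l) ⟨
    arcCost ((pre ∷ʳ x) ++ l) e              ≤⟨ arcCost-≤-maxCostFrom (pre ∷ʳ x) l e ⟩
    maxCostFrom (pre ∷ʳ x) (l ∷ʳ e)          ≤⟨ m≤n⊔m _ _ ⟩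
    maxCostFrom pre (x ∷ l ∷ʳ e)             ∎
    where open ≤-Reasoning

  _≟ᵃ_ : DecidableEquality (Arc n)
  _≟ᵃ_ = ≡-dec _≟ᶠ_ _≟ᶠ_

  open import Data.List.Membership.DecPropositional _≟ᵃ_ using (_∈?_)

  -- Membership rather than multiplicity is counted, so repetitions in the list never matter.
  adjacency : List (Arc n) → Fin n → Fin n → ℕ
  adjacency l v w = indicator ((v , w) ∈? l)

  ∑-indicator-arc-≤ : ∀ v e → sum (λ w → indicator ((v , w) ≟ᵃ e)) ≤ outCount v [ e ]
  ∑-indicator-arc-≤ v (i , j) with i ≟ᶠ v
  ... | yes refl = begin
    sum (λ w → indicator ((i , w) ≟ᵃ (i , j)))
      ≤⟨ sum-mono-≤ (λ w → indicator-mono ((i , w) ≟ᵃ (i , j)) (w ≟ᶠ j) (cong proj₂)) ⟩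
    sum (λ w → indicator (w ≟ᶠ j))   ≡⟨ sum-indicator-≟ j ⟩
    1                                ∎
    where open ≤-Reasoning
  ... | no i≢v = ≤-reflexive (sum-zero (λ w → indicator-no ((v , w) ≟ᵃ (i , j)) (i≢v ∘ sym ∘ cong proj₁)))

  ∑-adjacency-≤-outCount : ∀ l v → sum (adjacency l v) ≤ outCount v l
  ∑-adjacency-≤-outCount []      v = ≤-reflexive (sum-zero (λ w → indicator-no ((v , w) ∈? []) λ ()))
  ∑-adjacency-≤-outCount (e ∷ l) v = begin
    sum (adjacency (e ∷ l) v)
      ≤⟨ sum-mono-≤ (λ w → indicator-⊎ ((v , w) ∈? e ∷ l) ((v , w) ≟ᵃ e) ((v , w) ∈? l) toSum) ⟩
    sum (λ w → indicator ((v , w) ≟ᵃ e) + adjacency l v w)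
      ≡⟨ ∑-distrib-+ (λ w → indicator ((v , w) ≟ᵃ e)) (adjacency l v) ⟩
    sum (λ w → indicator ((v , w) ≟ᵃ e)) + sum (adjacency l v)
      ≤⟨ +-mono-≤ (∑-indicator-arc-≤ v e) (∑-adjacency-≤-outCount l v) ⟩
    outCount v [ e ] + outCount v l  ≡⟨ outCount-++ v [ e ] l ⟨
    outCount v (e ∷ l)               ∎
    where open ≤-Reasoning

module _ {n : ℕ} (T : OrderedTournament n) where
  open OrderedTournament T
  open import Data.List.Membership.DecPropositional (_≟ᵃ_ {n}) using (_∈?_)

  outDegree : Fin n → ℕ
  outDegree v = outCount v arcs

  outDegree-≤-cost : ∀ v → outDegree v ≤ cost T
  outDegree-≤-cost v = outCount-≤-maxCostFrom v [] arcs

  adjacency-total : ∀ v w → v ≢ w → 1 ≤ adjacency arcs v w + adjacency arcs w v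
  adjacency-total v w v≢w with complete v w v≢w
  ... | inj₁ vw∈ = ≤-trans (≤-reflexive (sym (indicator-yes ((v , w) ∈? arcs) vw∈))) (m≤m+n _ _)
  ... | inj₂ wv∈ = ≤-trans (≤-reflexive (sym (indicator-yes ((w , v) ∈? arcs) wv∈))) (m≤n+m _ _)

  square-≤-∑outDegree : n * n ≤ sum outDegree + sum outDegree + n
  square-≤-∑outDegree = ≤-trans (square-≤-∑∑-tournament (adjacency arcs) adjacency-total)
                                (+-monoˡ-≤ n (+-mono-≤ ∑adjacency≤ ∑adjacency≤))
    where
    ∑adjacency≤ : sum (λ v → sum (adjacency arcs v)) ≤ sum outDegree
    ∑adjacency≤ = sum-mono-≤ (∑-adjacency-≤-outCount arcs)

  last-arc-outDegree-≤-cost : ∀ pre {i j} → i ≢ j → arcs ≡ pre ∷ʳ (i , j) →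
                              outDegree i + outDegree j ≤ cost T
  last-arc-outDegree-≤-cost pre {i} {j} i≢j arcs≡ = begin
    outDegree i + outDegree j
      ≡⟨ cong (λ l → outCount i l + outCount j l) arcs≡ ⟩
    outCount i (pre ∷ʳ (i , j)) + outCount j (pre ∷ʳ (i , j))
      ≡⟨ arcCost-last pre i≢j ⟩
    arcCost pre (i , j)                   ≤⟨ arcCost-≤-maxCostFrom [] pre (i , j) ⟩
    maxCostFrom [] (pre ∷ʳ (i , j))       ≡⟨ cong (maxCostFrom []) arcs≡ ⟨
    cost T                                ∎
    where open ≤-Reasoning

arcs-∷ʳ : ∀ {m} (T : OrderedTournament (suc (suc m))) → ∃₂ λ pre e → OrderedTournament.arcs T ≡ pre ∷ʳ e
arcs-∷ʳ T with OrderedTournament.complete T zero (suc zero) (λ ())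
... | inj₁ 01∈ = ∈⇒∷ʳ 01∈
... | inj₂ 10∈ = ∈⇒∷ʳ 10∈

∑outDegree-≤-pred-* : ∀ {m} (T : OrderedTournament (suc (suc m))) → sum (outDegree T) ≤ suc m * cost T
∑outDegree-≤-pred-* T with arcs-∷ʳ T
... | pre , (i , j) , arcs≡ =
  sum-≤-pred-* (cost T) i≢j (outDegree-≤-cost T) (last-arc-outDegree-≤-cost T pre i≢j arcs≡)
  where
  i≢j : i ≢ j
  i≢j = proj₂ (∷ʳ⁻ (subst (All _) arcs≡ (OrderedTournament.noLoops T)))

≤-double-of-square : ∀ k s c .{{_ : NonZero k}} →
                     suc k * suc k ≤ s + s + suc k → s ≤ k * c → suc k ≤ c + c
≤-double-of-square k s c sq≤ s≤ = *-cancelˡ-≤ k (begin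
  k * suc k      ≤⟨ +-cancelˡ-≤ (suc k) _ _ (≤-trans sq≤ (≤-reflexive (+-comm (s + s) (suc k)))) ⟩
  s + s          ≤⟨ +-mono-≤ s≤ s≤ ⟩
  k * c + k * c  ≡⟨ *-distribˡ-+ k c c ⟨
  k * (c + c)    ∎)
  where open ≤-Reasoning

lemma5 : (n : ℕ) → 2 ≤ n → (T : OrderedTournament n) → ⌈ n /2⌉ ≤ cost T
lemma5 (suc zero)    (s≤s ()) _
lemma5 (suc (suc m)) _        T = begin
  ⌈ suc (suc m) /2⌉  ≤⟨ ⌈n/2⌉-mono n≤c+c ⟩
  ⌈ c + c /2⌉        ≡⟨ n≡⌈n+n/2⌉ c ⟨
  c                  ∎
  where
  open ≤-Reasoning
  c = cost T
  n≤c+c : suc (suc m) ≤ c + c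
  n≤c+c = ≤-double-of-square (suc m) (sum (outDegree T)) c
            (square-≤-∑outDegree T) (∑outDegree-≤-pred-* T)
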